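{- Let $k\geq 2$ be an integer, $\lambda$ a positive integer, and $a_{k,n}^{k}$ the $k$-th sequence of generalized order-$k$ numbers defined in the context. For $n\ge 1$ let $Q_{k,n}=(q_{st})$ be the $n\times n$ matrix with \[ q_{st}=\begin{cases}\iota^{|s-t|} & \text{if } -1\le s-t<k \text{ and } s\ne t,\\ \lambda & \text{if } s=t,\\ 0&\text{otherwise,}\end{cases} \] where $\iota=\sqrt{ -1}$. Then $\det(Q_{k,n})=a_{k,n+1}^{k}$ for all $n\ge 1$.
   Context: For a positive integer $k$ and a positive integer $\lambda$, the $k$ sequences of generalized order-$k$ numbers are defined as follows: for each $1\le i\le k$, the sequence $(a_{k,n}^{i})_{n\ge 1-k}$ has initial values $a_{k,n}^{i}=1$ if $i=1-n$ and $a_{k,n}^{i}=0$ otherwise, for $1-k\le n\le 0$, and satisfies $a_{k,n}^{i}=\lambda a_{k,n-1}^{i}+a_{k,n-2}^{i}+\cdots+a_{k,n-k}^{i}$ for $n\ge 1$. The $k$-th sequence is the one with $i=k$. -}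

module Defs where

open import Data.Nat as ℕ using (ℕ; zero; suc; _<ᵇ_; _≡ᵇ_)
open import Data.Integer as ℤ using (ℤ; +_)
open import Data.Product using (_×_; _,_)
open import Data.Bool using (if_then_else_)
open import Data.List using (List; []; _∷_; take; drop)
open import Data.Nat.ListAction using (sum)
open import Data.Fin using (Fin; toℕ; punchIn) renaming (zero to fzero; suc to fsuc)

-- Generalized order-k numbers a^i_{k,n}.
-- We index by m = n + k - 1 ≥ 0 (so m = 0 corresponds to n = 1 - k).
-- history k λ i m = [v(m-1), …, v(0)], where v(m) = a^i_{k, m+1-k}.

next : ℕ → ℕ → ℕ → ℕ → List ℕ → ℕ
next k λ' i m h =
  if m <ᵇ k
  then (if (m ℕ.+ i) ≡ᵇ k then 1 else 0)   -- initial: a^i_{k,n} = 1 iff i = 1 - n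
  else (λ' ℕ.* headOr h ℕ.+ sum (take (k ℕ.∸ 1) (drop 1 h)))
  where
  headOr : List ℕ → ℕ
  headOr [] = 0
  headOr (x ∷ _) = x

history : ℕ → ℕ → ℕ → ℕ → List ℕ
history k λ' i zero = []
history k λ' i (suc m) = next k λ' i m (history k λ' i m) ∷ history k λ' i m

genOrder : ℕ → ℕ → ℕ → ℕ → ℕ
genOrder k λ' i m = next k λ' i m (history k λ' i m)

aPos : ℕ → ℕ → ℕ → ℕ → ℕ
aPos k λ' i n = genOrder k λ' i (n ℕ.+ k ℕ.∸ 1)

-- Gaussian integers ℤ[ι] ⊂ ℂ, as pairs (re , im).

Gauss : Set
Gauss = ℤ × ℤ

_+ᴳ_ : Gauss → Gauss → Gauss
(a , b) +ᴳ (c , d) = (a ℤ.+ c , b ℤ.+ d)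

_*ᴳ_ : Gauss → Gauss → Gauss
(a , b) *ᴳ (c , d) = (a ℤ.* c ℤ.- b ℤ.* d , a ℤ.* d ℤ.+ b ℤ.* c)

-ᴳ_ : Gauss → Gauss
-ᴳ (a , b) = (ℤ.- a , ℤ.- b)

0ᴳ 1ᴳ ι : Gauss
0ᴳ = (+ 0 , + 0)
1ᴳ = (+ 1 , + 0)
ι  = (+ 0 , + 1)

fromℕᴳ : ℕ → Gauss
fromℕᴳ n = (+ n , + 0)

_^ᴳ_ : Gauss → ℕ → Gauss
x ^ᴳ zero = 1ᴳ
x ^ᴳ suc n = x *ᴳ (x ^ᴳ n)

sumFin : (n : ℕ) → (Fin n → Gauss) → Gauss
sumFin zero f = 0ᴳ
sumFin (suc n) f = f fzero +ᴳ sumFin n (λ j → f (fsuc j))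

det : (n : ℕ) → (Fin n → Fin n → Gauss) → Gauss
det zero M = 1ᴳ
det (suc n) M =
  sumFin (suc n) λ j →
    ((-ᴳ 1ᴳ) ^ᴳ toℕ j) *ᴳ (M fzero j *ᴳ det n (λ r c → M (fsuc r) (punchIn j c)))

qEntry : ℕ → ℕ → ℕ → ℕ → Gauss
qEntry k λ' s t =
  if s ≡ᵇ t then fromℕᴳ λ'
  else if suc s ≡ᵇ t then ι
  else if (t <ᵇ s) Data.Bool.∧ ((s ℕ.∸ t) <ᵇ k) then ι ^ᴳ (s ℕ.∸ t)
  else 0ᴳ

Q : ℕ → ℕ → (n : ℕ) → Fin n → Fin n → Gauss
Q k λ' n s t = qEntry k λ' (toℕ s) (toℕ t)

{-# OPTIONS --safe #-}
-- Expanding det Q_{k,n} along its first row (λ, ι, 0, …, 0) leaves two minors: Q_{k,n-1}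
-- itself, and a copy of Q_{k,n-1} whose first column is the subdiagonal part of the first
-- column of Q (entries ι^s for 1 ≤ s < k). Expanding the latter kind again and again, the
-- powers of ι pair up via ι² = -1, so D_n = det Q_{k,n} satisfies
-- D_{n+2} = λ D_{n+1} + D_n + ⋯ + D_{n+2-k}, with D_0 = 1 and D_1 = λ. The numbers
-- a^k_{k,n+1} obey the same recurrence with the same initial values, so the two agree.
module Submission where

open import Defs
open import Level using (0ℓ)
open import Data.Bool using (true; false; if_then_else_)
open import Data.Fin using (Fin; toℕ; punchIn) renaming (zero to fzero; suc to fsuc)
open import Data.Integer using (+_)
import Data.Integer.Properties as ℤₚ
import Data.Integer.Tactic.RingSolver as ℤ-Solver
open import Data.List using (List; take)
open import Data.Maybe using (just; nothing)
import Data.Nat as ℕ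
open import Data.Nat using (ℕ; zero; suc; _≤_; _<_; _∸_; _<ᵇ_; _≡ᵇ_; _<?_; z<s; s≤s)
import Data.Nat.Properties as ℕₚ
open import Data.Nat.Induction using (<-rec)
open import Data.Nat.ListAction using (sum)
open import Data.Product using (_,_)
open import Relation.Binary.PropositionalEquality
open import Algebra.Bundles using (CommutativeRing)
open import Algebra.Structures {A = Gauss} _≡_ using (IsCommutativeRing)
open import Relation.Nullary using (yes; no; ofʸ; ofⁿ; contradiction)
open import Tactic.RingSolver using (solve-∀)
open import Tactic.RingSolver.Core.AlmostCommutativeRing
  using (AlmostCommutativeRing; fromCommutativeRing)

module _ where
  open Data.Integer using (_*_; _+_; _-_)

  private
    *-assoc-re : ∀ a b c d e f →
      (a * c - b * d) * e - (a * d + b * c) * f ≡ a * (c * e - d * f) - b * (c * f + d * e)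
    *-assoc-re = ℤ-Solver.solve-∀
    *-assoc-im : ∀ a b c d e f →
      (a * c - b * d) * f + (a * d + b * c) * e ≡ a * (c * f + d * e) + b * (c * e - d * f)
    *-assoc-im = ℤ-Solver.solve-∀
    distribˡ-re : ∀ a b c d e f → a * (c + e) - b * (d + f) ≡ (a * c - b * d) + (a * e - b * f)
    distribˡ-re = ℤ-Solver.solve-∀
    distribˡ-im : ∀ a b c d e f → a * (d + f) + b * (c + e) ≡ (a * d + b * c) + (a * f + b * e)
    distribˡ-im = ℤ-Solver.solve-∀
    distribʳ-re : ∀ a b c d e f → (c + e) * a - (d + f) * b ≡ (c * a - d * b) + (e * a - f * b)
    distribʳ-re = ℤ-Solver.solve-∀
    distribʳ-im : ∀ a b c d e f → (c + e) * b + (d + f) * a ≡ (c * b + d * a) + (e * b + f * a)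
    distribʳ-im = ℤ-Solver.solve-∀
    *-comm-re : ∀ a b c d → a * c - b * d ≡ c * a - d * b
    *-comm-re = ℤ-Solver.solve-∀
    *-comm-im : ∀ a b c d → a * d + b * c ≡ c * b + d * a
    *-comm-im = ℤ-Solver.solve-∀
    *-identityˡ-re : ∀ a b → + 1 * a - + 0 * b ≡ a
    *-identityˡ-re = ℤ-Solver.solve-∀
    *-identityˡ-im : ∀ a b → + 1 * b + + 0 * a ≡ b
    *-identityˡ-im = ℤ-Solver.solve-∀
    *-identityʳ-re : ∀ a b → a * + 1 - b * + 0 ≡ a
    *-identityʳ-re = ℤ-Solver.solve-∀
    *-identityʳ-im : ∀ a b → a * + 0 + b * + 1 ≡ b
    *-identityʳ-im = ℤ-Solver.solve-∀

  gauss-isCommutativeRing : IsCommutativeRing _+ᴳ_ _*ᴳ_ -ᴳ_ 0ᴳ 1ᴳ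
  gauss-isCommutativeRing = record
    { isRing = record
      { +-isAbelianGroup = record
        { isGroup = record
          { isMonoid = record
            { isSemigroup = record
              { isMagma = record { isEquivalence = isEquivalence ; ∙-cong = cong₂ _+ᴳ_ }
              ; assoc = λ { (a , b) (c , d) (e , f) →
                  cong₂ _,_ (ℤₚ.+-assoc a c e) (ℤₚ.+-assoc b d f) }
              }
            ; identity = (λ { (a , b) → cong₂ _,_ (ℤₚ.+-identityˡ a) (ℤₚ.+-identityˡ b) })
                       , (λ { (a , b) → cong₂ _,_ (ℤₚ.+-identityʳ a) (ℤₚ.+-identityʳ b) })
            }
          ; inverse = (λ { (a , b) → cong₂ _,_ (ℤₚ.+-inverseˡ a) (ℤₚ.+-inverseˡ b) })
                    , (λ { (a , b) → cong₂ _,_ (ℤₚ.+-inverseʳ a) (ℤₚ.+-inverseʳ b) })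
          ; ⁻¹-cong = cong -ᴳ_
          }
        ; comm = λ { (a , b) (c , d) → cong₂ _,_ (ℤₚ.+-comm a c) (ℤₚ.+-comm b d) }
        }
      ; *-cong = cong₂ _*ᴳ_
      ; *-assoc = λ { (a , b) (c , d) (e , f) →
          cong₂ _,_ (*-assoc-re a b c d e f) (*-assoc-im a b c d e f) }
      ; *-identity = (λ { (a , b) → cong₂ _,_ (*-identityˡ-re a b) (*-identityˡ-im a b) })
                   , (λ { (a , b) → cong₂ _,_ (*-identityʳ-re a b) (*-identityʳ-im a b) })
      ; distrib = (λ { (a , b) (c , d) (e , f) →
                    cong₂ _,_ (distribˡ-re a b c d e f) (distribˡ-im a b c d e f) })
                , (λ { (a , b) (c , d) (e , f) →
                    cong₂ _,_ (distribʳ-re a b c d e f) (distribʳ-im a b c d e f) })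
      }
    ; *-comm = λ { (a , b) (c , d) → cong₂ _,_ (*-comm-re a b c d) (*-comm-im a b c d) }
    }

gauss-commutativeRing : CommutativeRing 0ℓ 0ℓ
gauss-commutativeRing = record { isCommutativeRing = gauss-isCommutativeRing }

gauss-ring : AlmostCommutativeRing 0ℓ 0ℓ
gauss-ring = fromCommutativeRing gauss-commutativeRing λ
  { (+ 0 , + 0) → just refl
  ; _ → nothing
  }

open AlmostCommutativeRing gauss-ring
  using (_+_; _*_; -_; 0#; 1#; *-assoc; *-identityˡ; *-identityʳ; zeroˡ; zeroʳ)

fromℕᴳ-+ : ∀ m n → fromℕᴳ (m ℕ.+ n) ≡ fromℕᴳ m + fromℕᴳ n
fromℕᴳ-+ m n = cong (_, + 0) (ℤₚ.pos-+ m n)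

fromℕᴳ-* : ∀ m n → fromℕᴳ (m ℕ.* n) ≡ fromℕᴳ m * fromℕᴳ n
fromℕᴳ-* m n = cong₂ _,_
  (trans (ℤₚ.pos-* m n) (sym (ℤₚ.+-identityʳ _)))
  (sym (trans (ℤₚ.+-identityʳ _) (ℤₚ.*-zeroʳ (+ m))))

n∸m≡1+[n∸1+m] : ∀ {m n} → m < n → n ∸ m ≡ suc (n ∸ suc m)
n∸m≡1+[n∸1+m] m<n = ℕₚ.+-∸-assoc 1 m<n

-[ι*[ι*x]]≡x : ∀ x → - (ι * (ι * x)) ≡ x
-- ι * ι reduces to - 1#
-[ι*[ι*x]]≡x x = trans (cong -_ (sym (*-assoc ι ι x))) (-[-1*x]≡x x)
  where
  -[-1*x]≡x : ∀ x → - (- 1# * x) ≡ x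
  -[-1*x]≡x = solve-∀ gauss-ring

sumFin-cong : ∀ n {f g : Fin n → Gauss} → (∀ j → f j ≡ g j) → sumFin n f ≡ sumFin n g
sumFin-cong zero    f≗g = refl
sumFin-cong (suc n) f≗g = cong₂ _+_ (f≗g fzero) (sumFin-cong n (λ j → f≗g (fsuc j)))

sumFin-zero : ∀ n {f : Fin n → Gauss} → (∀ j → f j ≡ 0#) → sumFin n f ≡ 0#
sumFin-zero zero    f≗0 = refl
sumFin-zero (suc n) f≗0 = cong₂ _+_ (f≗0 fzero) (sumFin-zero n (λ j → f≗0 (fsuc j)))

minor : ∀ {n} → (Fin (suc n) → Fin (suc n) → Gauss) → Fin (suc n) → Fin n → Fin n → Gauss
minor M j r c = M (fsuc r) (punchIn j c)

det-cong : ∀ n {M N : Fin n → Fin n → Gauss} → (∀ r c → M r c ≡ N r c) → det n M ≡ det n N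
det-cong zero    M≗N = refl
det-cong (suc n) M≗N = sumFin-cong (suc n) λ j →
  cong₂ (λ x d → ((-ᴳ 1ᴳ) ^ᴳ toℕ j) * (x * d))
        (M≗N fzero j) (det-cong n (λ r c → M≗N (fsuc r) (punchIn j c)))

det-1 : ∀ M → det 1 M ≡ M fzero fzero
det-1 M = 1*[x*1]+0≡x (M fzero fzero)
  where
  1*[x*1]+0≡x : ∀ x → 1# * (x * 1#) + 0# ≡ x
  1*[x*1]+0≡x = solve-∀ gauss-ring

det-expand-firstRow₂ : ∀ m M → (∀ j → M fzero (fsuc (fsuc j)) ≡ 0#) →
  det (suc (suc m)) M ≡
    M fzero fzero * det (suc m) (minor M fzero)
    + - (M fzero (fsuc fzero) * det (suc m) (minor M (fsuc fzero)))
det-expand-firstRow₂ m M row₀ = begin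
    det (suc (suc m)) M
  ≡⟨ cong (λ rest → 1# * (x * d₀) + ((- 1# * 1#) * (y * d₁) + rest))
          (sumFin-zero m term-vanishes) ⟩
    1# * (x * d₀) + ((- 1# * 1#) * (y * d₁) + 0#)
  ≡⟨ expansion x y d₀ d₁ ⟩
    x * d₀ + - (y * d₁)
  ∎
  where
  open ≡-Reasoning
  x = M fzero fzero
  y = M fzero (fsuc fzero)
  d₀ = det (suc m) (minor M fzero)
  d₁ = det (suc m) (minor M (fsuc fzero))
  s*[0*d]≡0 : ∀ s d → s * (0# * d) ≡ 0#
  s*[0*d]≡0 = solve-∀ gauss-ring
  term-vanishes : ∀ j → ((-ᴳ 1ᴳ) ^ᴳ toℕ (fsuc (fsuc j)))
                        * (M fzero (fsuc (fsuc j)) * det (suc m) (minor M (fsuc (fsuc j)))) ≡ 0#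
  term-vanishes j = trans (cong (λ z → sign * (z * dⱼ)) (row₀ j)) (s*[0*d]≡0 sign dⱼ)
    where
    sign = (-ᴳ 1ᴳ) ^ᴳ toℕ (fsuc (fsuc j))
    dⱼ = det (suc m) (minor M (fsuc (fsuc j)))
  expansion : ∀ x y d₀ d₁ → 1# * (x * d₀) + ((- 1# * 1#) * (y * d₁) + 0#) ≡ x * d₀ + - (y * d₁)
  expansion = solve-∀ gauss-ring

module WindowRecurrence (k λ' : ℕ) where

  inWindow : ℕ → Gauss
  inWindow j = if j <ᵇ k then 1ᴳ else 0ᴳ

  inWindow-inside : ∀ {j} → j < k → ∀ x → inWindow j * x ≡ x
  inWindow-inside {j} j<k x with j <ᵇ k | ℕₚ.<ᵇ-reflects-< j k
  ... | true  | _        = *-identityˡ x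
  ... | false | ofⁿ j≮k = contradiction j<k j≮k

  inWindow-outside : ∀ {j} → k ≤ j → ∀ x → inWindow j * x ≡ 0#
  inWindow-outside {j} k≤j x with j <ᵇ k | ℕₚ.<ᵇ-reflects-< j k
  ... | true  | ofʸ j<k = contradiction j<k (ℕₚ.≤⇒≯ k≤j)
  ... | false | _        = zeroˡ x

  -- For j = 1 this is
  -- u m + ⋯ + u (m + 2 ∸ k), the tail of the order-k recurrence; cutting it off at u 0
  -- is harmless for the a^k_{k,n} since a^k_{k,n} = 0 for 2 - k ≤ n ≤ 0.
  lagSum : (ℕ → Gauss) → ℕ → ℕ → Gauss
  lagSum u j zero    = inWindow j * u 0
  lagSum u j (suc m) = inWindow j * u (suc m) + lagSum u (suc j) m

  lagSum-cong : ∀ {u w} j m → (∀ i → i ≤ m → u i ≡ w i) → lagSum u j m ≡ lagSum w j m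
  lagSum-cong j zero    u≗w = cong (inWindow j *_) (u≗w 0 ℕ.z≤n)
  lagSum-cong j (suc m) u≗w =
    cong₂ _+_ (cong (inWindow j *_) (u≗w (suc m) ℕₚ.≤-refl))
              (lagSum-cong (suc j) m (λ i i≤m → u≗w i (ℕₚ.m≤n⇒m≤1+n i≤m)))

  lagSum-outside : ∀ {u j} m → k ≤ j → lagSum u j m ≡ 0#
  lagSum-outside zero    k≤j = inWindow-outside k≤j _
  lagSum-outside (suc m) k≤j =
    cong₂ _+_ (inWindow-outside k≤j _) (lagSum-outside m (ℕₚ.m≤n⇒m≤1+n k≤j))

  SatisfiesRecurrence : (ℕ → Gauss) → Set
  SatisfiesRecurrence u = ∀ m → u (suc (suc m)) ≡ fromℕᴳ λ' * u (suc m) + lagSum u 1 m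

  solution-unique : ∀ {u w} → u 0 ≡ w 0 → u 1 ≡ w 1 →
    SatisfiesRecurrence u → SatisfiesRecurrence w → ∀ m → u m ≡ w m
  solution-unique {u} {w} u₀ u₁ rec-u rec-w = <-rec (λ m → u m ≡ w m) step
    where
    step : ∀ m → (∀ {i} → i < m → u i ≡ w i) → u m ≡ w m
    step zero          _  = u₀
    step (suc zero)    _  = u₁
    step (suc (suc m)) ih = begin
        u (suc (suc m))
      ≡⟨ rec-u m ⟩
        fromℕᴳ λ' * u (suc m) + lagSum u 1 m
      ≡⟨ cong₂ (λ x y → fromℕᴳ λ' * x + y)
               (ih ℕₚ.≤-refl) (lagSum-cong 1 m (λ i i≤m → ih (s≤s (ℕₚ.m≤n⇒m≤1+n i≤m)))) ⟩
        fromℕᴳ λ' * w (suc m) + lagSum w 1 m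
      ≡⟨ rec-w m ⟨
        w (suc (suc m))
      ∎
      where open ≡-Reasoning

module GeneralizedOrderNumbers (k λ' : ℕ) where
  open WindowRecurrence k λ'

  g : ℕ → ℕ
  g = genOrder k λ' k

  hist : ℕ → List ℕ
  hist = history k λ' k

  A : ℕ → Gauss
  A m = fromℕᴳ (aPos k λ' k (suc m))

  genOrder-zero : 1 ≤ k → g 0 ≡ 1
  genOrder-zero 1≤k with 0 <ᵇ k | ℕₚ.<ᵇ-reflects-< 0 k | k ≡ᵇ k | ℕₚ.≡⇒≡ᵇ k k refl
  ... | true  | _        | true | _ = refl
  ... | false | ofⁿ 0≮k | _    | _ = contradiction 1≤k 0≮k

  genOrder-initial≡0 : ∀ {m} → 1 ≤ m → m < k → g m ≡ 0
  genOrder-initial≡0 {suc m} _ m<k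
    with suc m <ᵇ k | ℕₚ.<ᵇ-reflects-< (suc m) k | suc m ℕ.+ k ≡ᵇ k | ℕₚ.≡ᵇ⇒≡ (suc m ℕ.+ k) k
  ... | true  | _        | false | _         = refl
  ... | true  | _        | true  | 1+m+k≡k =
    contradiction (ℕₚ.+-cancelʳ-≡ k (suc m) 0 (1+m+k≡k _)) λ ()
  ... | false | ofⁿ m≮k | _     | _         = contradiction m<k m≮k

  genOrder-step : ∀ m → k ≤ suc m → g (suc m) ≡ λ' ℕ.* g m ℕ.+ sum (take (k ∸ 1) (hist m))
  genOrder-step m k≤1+m with suc m <ᵇ k | ℕₚ.<ᵇ-reflects-< (suc m) k
  ... | false | _        = refl
  ... | true  | ofʸ m<k = contradiction m<k (ℕₚ.≤⇒≯ k≤1+m)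

  sum-take-history≡0 : ∀ r M → r < M → M ≤ k → sum (take r (hist M)) ≡ 0
  sum-take-history≡0 zero    M             _             _   = refl
  sum-take-history≡0 (suc r) (suc (suc M)) (s≤s r<1+M) 2+M≤k =
    cong₂ ℕ._+_ (genOrder-initial≡0 (s≤s ℕ.z≤n) 2+M≤k)
                (sum-take-history≡0 r (suc M) r<1+M (ℕₚ.<⇒≤ 2+M≤k))

  sum-take-history≡1 : ∀ M → 1 ≤ M → M ≤ k → sum (take M (hist M)) ≡ 1
  sum-take-history≡1 (suc zero)    _ 1≤k   = cong (ℕ._+ 0) (genOrder-zero 1≤k)
  sum-take-history≡1 (suc (suc M)) _ 2+M≤k =
    cong₂ ℕ._+_ (genOrder-initial≡0 (s≤s ℕ.z≤n) 2+M≤k)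
                (sum-take-history≡1 (suc M) (s≤s ℕ.z≤n) (ℕₚ.<⇒≤ 2+M≤k))

  genOrder-k : 2 ≤ k → g k ≡ 1
  genOrder-k 2≤k = begin
      g k
    ≡⟨ cong g k≡1+k₁ ⟩
      g (suc k₁)
    ≡⟨ genOrder-step k₁ (ℕₚ.≤-reflexive k≡1+k₁) ⟩
      λ' ℕ.* g k₁ ℕ.+ sum (take k₁ (hist k₁))
    ≡⟨ cong₂ (λ x y → λ' ℕ.* x ℕ.+ y)
             (genOrder-initial≡0 1≤k₁ k₁<k) (sum-take-history≡1 k₁ 1≤k₁ (ℕₚ.<⇒≤ k₁<k)) ⟩
      λ' ℕ.* 0 ℕ.+ 1
    ≡⟨ cong (ℕ._+ 1) (ℕₚ.*-zeroʳ λ') ⟩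
      1
    ∎
    where
    open ≡-Reasoning
    k₁ = k ∸ 1
    k≡1+k₁ : k ≡ suc k₁
    k≡1+k₁ = sym (ℕₚ.m+[n∸m]≡n (ℕₚ.<⇒≤ 2≤k))
    1≤k₁ : 1 ≤ k₁
    1≤k₁ = ℕₚ.∸-monoˡ-≤ 1 2≤k
    k₁<k : k₁ < k
    k₁<k = ℕₚ.≤-reflexive (sym k≡1+k₁)

  genOrder-1+k : 2 ≤ k → g (suc k) ≡ λ'
  genOrder-1+k 2≤k = begin
      g (suc k)
    ≡⟨ genOrder-step k (ℕₚ.n≤1+n k) ⟩
      λ' ℕ.* g k ℕ.+ sum (take (k ∸ 1) (hist k))
    ≡⟨ cong₂ (λ x y → λ' ℕ.* x ℕ.+ y)
             (genOrder-k 2≤k) (sum-take-history≡0 (k ∸ 1) k k∸1<k ℕₚ.≤-refl) ⟩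
      λ' ℕ.* 1 ℕ.+ 0
    ≡⟨ trans (ℕₚ.+-identityʳ _) (ℕₚ.*-identityʳ λ') ⟩
      λ'
    ∎
    where
    open ≡-Reasoning
    k∸1<k : k ∸ 1 < k
    k∸1<k = ℕₚ.∸-monoʳ-< z<s (ℕₚ.<⇒≤ 2≤k)

  history-window≡lagSum : ∀ j m → fromℕᴳ (sum (take (k ∸ j) (hist (suc m ℕ.+ k)))) ≡ lagSum A j m
  history-window≡lagSum j m with j <? k
  history-window≡lagSum j m | no j≮k = begin
      fromℕᴳ (sum (take (k ∸ j) (hist (suc m ℕ.+ k))))
    ≡⟨ cong (λ r → fromℕᴳ (sum (take r (hist (suc m ℕ.+ k))))) (ℕₚ.m≤n⇒m∸n≡0 (ℕₚ.≮⇒≥ j≮k)) ⟩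
      0#
    ≡⟨ lagSum-outside m (ℕₚ.≮⇒≥ j≮k) ⟨
      lagSum A j m
    ∎
    where open ≡-Reasoning
  history-window≡lagSum j zero | yes j<k = begin
      fromℕᴳ (sum (take (k ∸ j) (hist (suc k))))
    ≡⟨ cong (λ r → fromℕᴳ (sum (take r (hist (suc k))))) (n∸m≡1+[n∸1+m] j<k) ⟩
      fromℕᴳ (g k ℕ.+ sum (take (k ∸ suc j) (hist k)))
    ≡⟨ cong (λ s → fromℕᴳ (g k ℕ.+ s))
            (sum-take-history≡0 (k ∸ suc j) k (ℕₚ.∸-monoʳ-< z<s j<k) ℕₚ.≤-refl) ⟩
      fromℕᴳ (g k ℕ.+ 0)
    ≡⟨ cong fromℕᴳ (ℕₚ.+-identityʳ (g k)) ⟩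
      A 0
    ≡⟨ inWindow-inside j<k (A 0) ⟨
      lagSum A j zero
    ∎
    where open ≡-Reasoning
  history-window≡lagSum j (suc m) | yes j<k = begin
      fromℕᴳ (sum (take (k ∸ j) (hist (suc (suc m) ℕ.+ k))))
    ≡⟨ cong (λ r → fromℕᴳ (sum (take r (hist (suc (suc m) ℕ.+ k))))) (n∸m≡1+[n∸1+m] j<k) ⟩
      fromℕᴳ (g (suc m ℕ.+ k) ℕ.+ sum (take (k ∸ suc j) (hist (suc m ℕ.+ k))))
    ≡⟨ fromℕᴳ-+ (g (suc m ℕ.+ k)) _ ⟩
      A (suc m) + fromℕᴳ (sum (take (k ∸ suc j) (hist (suc m ℕ.+ k))))
    ≡⟨ cong₂ _+_ (sym (inWindow-inside j<k (A (suc m)))) (history-window≡lagSum (suc j) m) ⟩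
      lagSum A j (suc m)
    ∎
    where open ≡-Reasoning

  A-satisfiesRecurrence : SatisfiesRecurrence A
  A-satisfiesRecurrence m = begin
      fromℕᴳ (g (suc (suc m ℕ.+ k)))
    ≡⟨ cong fromℕᴳ (genOrder-step (suc m ℕ.+ k) (ℕₚ.m≤n+m k (suc (suc m)))) ⟩
      fromℕᴳ (λ' ℕ.* g (suc m ℕ.+ k) ℕ.+ sum (take (k ∸ 1) (hist (suc m ℕ.+ k))))
    ≡⟨ fromℕᴳ-+ (λ' ℕ.* g (suc m ℕ.+ k)) _ ⟩
      fromℕᴳ (λ' ℕ.* g (suc m ℕ.+ k)) + fromℕᴳ (sum (take (k ∸ 1) (hist (suc m ℕ.+ k))))
    ≡⟨ cong₂ _+_ (fromℕᴳ-* λ' (g (suc m ℕ.+ k))) (history-window≡lagSum 1 m) ⟩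
      fromℕᴳ λ' * A (suc m) + lagSum A 1 m
    ∎
    where open ≡-Reasoning

module QDeterminant (k λ' : ℕ) where
  open WindowRecurrence k λ'

  D : ℕ → Gauss
  D n = det n (Q k λ' n)

  qEntryᵛ : (ℕ → Gauss) → ℕ → ℕ → Gauss
  qEntryᵛ v s zero    = v s
  qEntryᵛ v s (suc t) = qEntry k λ' s (suc t)

  Qᵛ : (ℕ → Gauss) → (n : ℕ) → Fin n → Fin n → Gauss
  Qᵛ v n s t = qEntryᵛ v (toℕ s) (toℕ t)

  detᵛ : (ℕ → Gauss) → ℕ → Gauss
  detᵛ v n = det n (Qᵛ v n)

  column : ℕ → ℕ → Gauss
  column j s = qEntry k λ' (j ℕ.+ s) 0

  qEntry-subdiagonal : ∀ s → qEntry k λ' (suc s) 0 ≡ ι ^ᴳ suc s * inWindow (suc s)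
  qEntry-subdiagonal s with suc s <ᵇ k
  ... | true  = sym (*-identityʳ (ι ^ᴳ suc s))
  ... | false = sym (zeroʳ (ι ^ᴳ suc s))

  D≡detᵛ-column : ∀ n → D n ≡ detᵛ (column 0) n
  D≡detᵛ-column n = det-cong n λ where
    r fzero    → refl
    r (fsuc c) → refl

  detᵛ-cong : ∀ {v w} n → (∀ s → v s ≡ w s) → detᵛ v n ≡ detᵛ w n
  detᵛ-cong n v≗w = det-cong n λ where
    r fzero    → v≗w (toℕ r)
    r (fsuc c) → refl

  detᵛ-1 : ∀ v → detᵛ v 1 ≡ v 0
  detᵛ-1 v = det-1 (Qᵛ v 1)

  -- qEntry depends only on s - t, so deleting row 0 and column 0 of Qᵛ v leaves Q,
  -- and deleting row 0 and column 1 leaves Qᵛ of the shifted column.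
  detᵛ-expand : ∀ v m →
    detᵛ v (suc (suc m)) ≡ v 0 * D (suc m) + - (ι * detᵛ (λ s → v (suc s)) (suc m))
  detᵛ-expand v m = trans (det-expand-firstRow₂ m Mᵛ (λ _ → refl))
    (cong (λ d → v 0 * D (suc m) + - (ι * d))
          (det-cong (suc m) {minor Mᵛ (fsuc fzero)} {Qᵛ (λ s → v (suc s)) (suc m)} λ where
            r fzero    → refl
            r (fsuc c) → refl))
    where
    Mᵛ = Qᵛ v (suc (suc m))

  detᵛ-column : ∀ j m → detᵛ (column (suc j)) (suc m) ≡ ι ^ᴳ suc j * lagSum D (suc j) m
  detᵛ-column j zero = begin
      detᵛ (column (suc j)) 1
    ≡⟨ detᵛ-1 (column (suc j)) ⟩
      qEntry k λ' (suc (j ℕ.+ 0)) 0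
    ≡⟨ cong (λ r → qEntry k λ' (suc r) 0) (ℕₚ.+-identityʳ j) ⟩
      qEntry k λ' (suc j) 0
    ≡⟨ qEntry-subdiagonal j ⟩
      ι ^ᴳ suc j * inWindow (suc j)
    ≡⟨ cong (ι ^ᴳ suc j *_) (*-identityʳ (inWindow (suc j))) ⟨
      ι ^ᴳ suc j * lagSum D (suc j) 0
    ∎
    where open ≡-Reasoning
  detᵛ-column j (suc m) = begin
      detᵛ (column (suc j)) (suc (suc m))
    ≡⟨ detᵛ-expand (column (suc j)) m ⟩
      column (suc j) 0 * D (suc m) + - (ι * detᵛ (λ s → column (suc j) (suc s)) (suc m))
    ≡⟨ cong₂ (λ x d → x * D (suc m) + - (ι * d))
             (trans (cong (λ r → qEntry k λ' (suc r) 0) (ℕₚ.+-identityʳ j)) (qEntry-subdiagonal j))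
             (trans (detᵛ-cong (suc m) (λ s → cong (λ r → qEntry k λ' (suc r) 0) (ℕₚ.+-suc j s)))
                    (detᵛ-column (suc j) m)) ⟩
      (x * w) * D (suc m) + - (ι * ((ι * x) * lagSum D (suc (suc j)) m))
    ≡⟨ cong (λ z → (x * w) * D (suc m) + - (ι * z)) (*-assoc ι x _) ⟩
      (x * w) * D (suc m) + - (ι * (ι * (x * lagSum D (suc (suc j)) m)))
    ≡⟨ cong (_+_ (x * w * D (suc m))) (-[ι*[ι*x]]≡x _) ⟩
      (x * w) * D (suc m) + x * lagSum D (suc (suc j)) m
    ≡⟨ factor x w (D (suc m)) _ ⟩
      x * lagSum D (suc j) (suc m)
    ∎
    where
    open ≡-Reasoning
    x = ι ^ᴳ suc j
    w = inWindow (suc j)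
    factor : ∀ x w d t → (x * w) * d + x * t ≡ x * (w * d + t)
    factor = solve-∀ gauss-ring

  D-satisfiesRecurrence : SatisfiesRecurrence D
  D-satisfiesRecurrence m = begin
      D (suc (suc m))
    ≡⟨ D≡detᵛ-column (suc (suc m)) ⟩
      detᵛ (column 0) (suc (suc m))
    ≡⟨ detᵛ-expand (column 0) m ⟩
      fromℕᴳ λ' * D (suc m) + - (ι * detᵛ (column 1) (suc m))
    ≡⟨ cong (λ d → fromℕᴳ λ' * D (suc m) + - (ι * d)) (detᵛ-column 0 m) ⟩
      fromℕᴳ λ' * D (suc m) + - (ι * ((ι * 1#) * lagSum D 1 m))
    ≡⟨ cong (λ z → fromℕᴳ λ' * D (suc m) + - (ι * z)) (*-assoc ι 1# (lagSum D 1 m)) ⟩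
      fromℕᴳ λ' * D (suc m) + - (ι * (ι * (1# * lagSum D 1 m)))
    ≡⟨ cong (_+_ (fromℕᴳ λ' * D (suc m))) (trans (-[ι*[ι*x]]≡x _) (*-identityˡ _)) ⟩
      fromℕᴳ λ' * D (suc m) + lagSum D 1 m
    ∎
    where open ≡-Reasoning

  D-one : D 1 ≡ fromℕᴳ λ'
  D-one = det-1 (Q k λ' 1)

theorem1p7 : (k λ' n : ℕ) → 2 ≤ k → 1 ≤ λ' → 1 ≤ n →
    det n (Q k λ' n) ≡ fromℕᴳ (aPos k λ' k (n Data.Nat.+ 1))
theorem1p7 k λ' n 2≤k _ _ = begin
    det n (Q k λ' n)
  ≡⟨ solution-unique (cong fromℕᴳ (sym (genOrder-k 2≤k)))
                     (trans D-one (cong fromℕᴳ (sym (genOrder-1+k 2≤k))))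
                     D-satisfiesRecurrence A-satisfiesRecurrence n ⟩
    fromℕᴳ (aPos k λ' k (suc n))
  ≡⟨ cong (λ i → fromℕᴳ (aPos k λ' k i)) (ℕₚ.+-comm 1 n) ⟩
    fromℕᴳ (aPos k λ' k (n ℕ.+ 1))
  ∎
  where
  open ≡-Reasoning
  open WindowRecurrence k λ'
  open GeneralizedOrderNumbers k λ'
  open QDeterminant k λ'
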